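{- Let $P$ be a finite poset, let $L$ be the lattice of lower order ideals of $P$, and let $(I,J)$ be an order minor of $P$. Then the minor $((L,\operatorname{irr}(L))|_{I\cup J})/J$ of $(L,\operatorname{irr}(L))$ is isomorphic to the minimally generated lattice $(M,\operatorname{irr}(M))$ of lower order ideals of the induced subposet $I$ of $P$.
   Context: An order minor of $P$ is a pair $(I,J)$ of disjoint subsets of $P$ such that $J$ is a lower order ideal of $P$. $L$ is ordered by inclusion; its join irreducibles $\operatorname{irr}(L)$ are the principal ideals $\downarrow p$, $p\in P$, and subsets $S\subseteq P$ are identified with the generator sets $\{\downarrow p:p\in S\}$. $M$ is the lattice of lower order ideals of $I$ with the induced order, and $\operatorname{irr}(M)$ its join irreducibles. A generator enriched lattice is a pair $(L,G)$ with $L$ a finite lattice and $G\subseteq L\setminus\{\widehat0\}$ generating $L$ under joins. For $H\subseteq L$ and $z<h$ for all $h\in H$, $\langle H|z\rangle=(\{z\}\cup\{\bigvee_{x\in S}x:\emptyset\ne S\subseteq H\},H)$. For $I'\subseteq G$: deletion $(L,G)\setminus I'=\langle G\setminus I'|\widehat0_L\rangle$; with $i_0=\bigvee I'$ and $J'=\{g\vee i_0:g\in G\}\setminus\{i_0\}$, contraction $(L,G)/I'=\langle J'|i_0\rangle$; restriction $(L,G)|_{I'}=(L,G)\setminus(G\setminus I')$. Generator enriched lattices $(K,H)$ and $(M,H')$ are isomorphic if there is a join-preserving bijection $f:K\to M$ with $f(H\cup\{\widehat0_K\})=H'\cup\{\widehat0_M\}$. -}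

module Defs where

open import Level using (0ℓ)
open import Data.Bool using (Bool; true; false)
open import Data.Nat using (ℕ)
open import Data.Fin using (Fin)
open import Data.Fin.Subset using (Subset; _∈_; _∉_; _⊆_; _∪_; _∩_; ⊥)
open import Data.Fin.Subset.Properties using (_∈?_)
open import Data.Vec using (tabulate)
open import Data.List using (List; []; map; filter; foldr; allFin)
open import Data.List.Relation.Unary.All using (All)
open import Data.Product using (Σ; Σ-syntax; _×_)
open import Data.Sum using (_⊎_)
open import Relation.Nullary using (¬_; does)
open import Relation.Binary.PropositionalEquality using (_≡_; _≢_)
open import Relation.Binary.Structures using (IsDecPartialOrder)

record FinPoset (n : ℕ) : Set₁ where
  field
    _≤_ : Fin n → Fin n → Set
    isDecPartialOrder : IsDecPartialOrder _≡_ _≤_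
  open IsDecPartialOrder isDecPartialOrder public using (_≤?_)

module _ {n : ℕ} (P : FinPoset n) where
  open FinPoset P

  IsLowerIdeal : Subset n → Set
  IsLowerIdeal X = ∀ x y → y ≤ x → x ∈ X → y ∈ X

  ↓ : Fin n → Subset n
  ↓ p = tabulate (λ y → does (y ≤? p))

  IsOrderMinor : Subset n → Subset n → Set
  IsOrderMinor I J = (∀ x → x ∈ I → x ∉ J) × IsLowerIdeal J

  -- lower order ideals of the induced subposet I (as subsets of I ⊆ P)
  IsLowerIdealOf : Subset n → Subset n → Set
  IsLowerIdealOf I X = X ⊆ I × (∀ x y → y ∈ I → y ≤ x → x ∈ X → y ∈ X)

-- Generator enriched lattices whose elements are subsets of Fin n, with
-- order inclusion and join union (all lattices in the statement are
-- join-closed families of subsets of P, so their joins are unions).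

⋁ : ∀ {n} → Subset n → List (Subset n) → Subset n
⋁ z S = foldr _∪_ z S

record GEL (n : ℕ) : Set₁ where
  field
    carrier : Subset n → Set
    bot     : Subset n
    gens    : Subset n → Set

JoinIrr : ∀ {n} → (Subset n → Set) → Subset n → Subset n → Set
JoinIrr C z x = C x × x ≢ z ×
  (∀ a b → C a → C b → a ∪ b ≡ x → (a ≡ x ⊎ b ≡ x))

gen⟨_∣_⟩ : {n : ℕ} → (Subset n → Set) → Subset n → GEL n
gen⟨_∣_⟩ {n} H z = record
  { carrier = λ x → x ≡ z ⊎ Σ[ S ∈ List (Subset n) ] (S ≢ [] × All H S × x ≡ ⋁ ⊥ S)
  ; bot = z
  ; gens = H }

deletion : ∀ {n} → GEL n → (Subset n → Set) → GEL n
deletion K I' = gen⟨ (λ g → GEL.gens K g × ¬ I' g) ∣ GEL.bot K ⟩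

restriction : ∀ {n} → GEL n → (Subset n → Set) → GEL n
restriction K I' = deletion K (λ g → GEL.gens K g × ¬ I' g)

-- contraction (L,G)/I', the finite set I' ⊆ G given as a list
contraction : ∀ {n} → GEL n → List (Subset n) → GEL n
contraction K I' = gen⟨ J' ∣ i₀ ⟩
  where
  i₀ = ⋁ (GEL.bot K) I'
  J' = λ y → Σ[ g ∈ Subset _ ] (GEL.gens K g × y ≡ g ∪ i₀ × y ≢ i₀)

record GELIso {n m : ℕ} (K : GEL n) (M : GEL m) : Set where
  open GEL
  field
    f       : Subset n → Subset m
    f-into  : ∀ x → carrier K x → carrier M (f x)
    f-inj   : ∀ x y → carrier K x → carrier K y → f x ≡ f y → x ≡ y
    f-surj  : ∀ y → carrier M y → Σ[ x ∈ Subset n ] (carrier K x × f x ≡ y)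
    f-join  : ∀ x y → carrier K x → carrier K y → f (x ∪ y) ≡ f x ∪ f y
    f-gens  : ∀ x → (gens K x ⊎ x ≡ bot K) → (gens M (f x) ⊎ f x ≡ bot M)
    f-gens⁻ : ∀ y → (gens M y ⊎ y ≡ bot M) →
              Σ[ x ∈ Subset n ] (carrier K x × (gens K x ⊎ x ≡ bot K) × f x ≡ y)

module _ {n : ℕ} (P : FinPoset n) where

  Lgel : GEL n
  Lgel = record
    { carrier = IsLowerIdeal P
    ; bot = ⊥
    ; gens = JoinIrr (IsLowerIdeal P) ⊥ }

  -- S ⊆ P identified with the generator set { ↓p : p ∈ S }
  genSet : Subset n → Subset n → Set
  genSet S g = Σ[ p ∈ Fin n ] (p ∈ S × g ≡ ↓ P p)

  genList : Subset n → List (Subset n)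
  genList S = map (↓ P) (filter (_∈? S) (allFin n))

  minorGEL : Subset n → Subset n → GEL n
  minorGEL I J = contraction (restriction Lgel (genSet (I ∪ J))) (genList J)

  Mgel : Subset n → GEL n
  Mgel I = record
    { carrier = IsLowerIdealOf P I
    ; bot = ⊥
    ; gens = JoinIrr (IsLowerIdealOf P I) ⊥ }

-- The isomorphism is x ↦ x ∩ I.  The join-irreducibles of L are the principal
-- ideals ↓q, so after restricting to I ∪ J and contracting by J (whose join is
-- J itself, J being an ideal) the generators become ↓q ∪ J with q ∈ I, and
-- every element of the minor is a lower ideal x ⊇ J each of whose points lies
-- in J or below a point of x ∩ I.  Such an x is recovered from x ∩ I, which
-- gives injectivity; ↓q ∪ J is sent to ↓q ∩ I, the join-irreducible of M
-- generated by q, and these generate M.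
module Submission where

open import Defs
open import Data.Nat using (ℕ)
open import Data.Fin using (Fin)
open import Data.Fin.Subset using (Subset; _∈_; _∉_; _⊆_; _∪_; _∩_; ⊥)
open import Data.Fin.Subset.Properties
  using (_∈?_; ⊆-antisym; ∉⊥; x∈p∪q⁻; x∈p∪q⁺; x∈p∩q⁻; x∈p∩q⁺; q⊆p∪q; ∪-comm; ∪-assoc; ∪-identityʳ; ∩-distribʳ-∪)
open import Data.Vec.Properties using (lookup∘tabulate; []=⇒lookup; lookup⇒[]=)
open import Data.List using (List; []; _∷_; map; filter; allFin)
open import Data.List.Properties using (map-∘; map-cong)
open import Data.List.Relation.Unary.All as All using (All; []; _∷_)
open import Data.List.Relation.Unary.Any using (here; there)
open import Data.List.Membership.Propositional using () renaming (_∈_ to _∈ₗ_)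
open import Data.List.Membership.Propositional.Properties using (∈-map⁺; ∈-map⁻; ∈-filter⁺; ∈-filter⁻; ∈-allFin)
open import Data.Product using (Σ-syntax; _×_; _,_; proj₁; proj₂)
open import Data.Sum using (_⊎_; inj₁; inj₂; [_,_]′; map₂)
open import Data.Empty using (⊥-elim)
open import Relation.Nullary using (yes; no; does)
open import Relation.Nullary.Decidable using (dec-true)
open import Relation.Binary.PropositionalEquality using (_≡_; refl; sym; trans; cong; cong₂; subst; module ≡-Reasoning)
open import Relation.Binary.Structures using (IsDecPartialOrder)

module _ {n : ℕ} where
  open ≡-Reasoning

  p⊆q⇒p∪q≡q : {p q : Subset n} → p ⊆ q → p ∪ q ≡ q
  p⊆q⇒p∪q≡q {p} {q} p⊆q = ⊆-antisym (λ x∈ → [ p⊆q , (λ x∈q → x∈q) ]′ (x∈p∪q⁻ p q x∈)) (q⊆p∪q p q)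

  ⋁≡∪⋁⊥ : (z : Subset n) (S : List (Subset n)) → ⋁ z S ≡ z ∪ ⋁ ⊥ S
  ⋁≡∪⋁⊥ z [] = sym (∪-identityʳ z)
  ⋁≡∪⋁⊥ z (s ∷ S) = begin
    s ∪ ⋁ z S         ≡⟨ cong (s ∪_) (⋁≡∪⋁⊥ z S) ⟩
    s ∪ (z ∪ ⋁ ⊥ S)   ≡⟨ sym (∪-assoc s z (⋁ ⊥ S)) ⟩
    (s ∪ z) ∪ ⋁ ⊥ S   ≡⟨ cong (_∪ ⋁ ⊥ S) (∪-comm s z) ⟩
    (z ∪ s) ∪ ⋁ ⊥ S   ≡⟨ ∪-assoc z s (⋁ ⊥ S) ⟩
    z ∪ (s ∪ ⋁ ⊥ S)   ∎

  ⋁-absorbs : {z s : Subset n} (S : List (Subset n)) → z ⊆ s → ⋁ z (s ∷ S) ≡ ⋁ ⊥ (s ∷ S)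
  ⋁-absorbs {z} {s} S z⊆s = begin
    ⋁ z (s ∷ S)       ≡⟨ ⋁≡∪⋁⊥ z (s ∷ S) ⟩
    z ∪ (s ∪ ⋁ ⊥ S)   ≡⟨ sym (∪-assoc z s (⋁ ⊥ S)) ⟩
    (z ∪ s) ∪ ⋁ ⊥ S   ≡⟨ cong (_∪ ⋁ ⊥ S) (p⊆q⇒p∪q≡q z⊆s) ⟩
    s ∪ ⋁ ⊥ S         ∎

  ⋁-∩ : (z X : Subset n) (S : List (Subset n)) → ⋁ z S ∩ X ≡ ⋁ (z ∩ X) (map (_∩ X) S)
  ⋁-∩ z X [] = refl
  ⋁-∩ z X (s ∷ S) = trans (∩-distribʳ-∪ X s (⋁ z S)) (cong (s ∩ X ∪_) (⋁-∩ z X S))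

  ∈-⋁⁻ : ∀ {x} (z : Subset n) (S : List (Subset n)) →
         x ∈ ⋁ z S → x ∈ z ⊎ Σ[ s ∈ Subset n ] (s ∈ₗ S × x ∈ s)
  ∈-⋁⁻ z [] x∈ = inj₁ x∈
  ∈-⋁⁻ z (s ∷ S) x∈ with x∈p∪q⁻ s (⋁ z S) x∈
  ... | inj₁ x∈s = inj₂ (s , here refl , x∈s)
  ... | inj₂ x∈⋁ with ∈-⋁⁻ z S x∈⋁
  ...   | inj₁ x∈z = inj₁ x∈z
  ...   | inj₂ (t , t∈S , x∈t) = inj₂ (t , there t∈S , x∈t)

  ∈-⋁⁺ : ∀ {x s z} {S : List (Subset n)} → s ∈ₗ S → x ∈ s → x ∈ ⋁ z S
  ∈-⋁⁺ (here refl) x∈s = x∈p∪q⁺ (inj₁ x∈s)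
  ∈-⋁⁺ (there s∈S) x∈s = x∈p∪q⁺ (inj₂ (∈-⋁⁺ s∈S x∈s))

  family : (Fin n → Subset n) → Subset n → List (Subset n)
  family d Y = map d (filter (_∈? Y) (allFin n))

  ∈-family⁻ : ∀ {d Y s} → s ∈ₗ family d Y → Σ[ p ∈ Fin n ] (p ∈ Y × s ≡ d p)
  ∈-family⁻ {d} {Y} s∈ with ∈-map⁻ d s∈
  ... | p , p∈ , s≡dp = p , proj₂ (∈-filter⁻ (_∈? Y) {xs = allFin n} p∈) , s≡dp

  All-family : ∀ {Q : Subset n → Set} {d Y} → (∀ {p} → p ∈ Y → Q (d p)) → All Q (family d Y)
  All-family {Q} Qd = All.tabulate λ s∈ → let p , p∈Y , s≡dp = ∈-family⁻ s∈ in subst Q (sym s≡dp) (Qd p∈Y)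

  ∈-⋁-family⁻ : ∀ {x} z d Y → x ∈ ⋁ z (family d Y) → x ∈ z ⊎ Σ[ p ∈ Fin n ] (p ∈ Y × x ∈ d p)
  ∈-⋁-family⁻ z d Y x∈ with ∈-⋁⁻ z (family d Y) x∈
  ... | inj₁ x∈z = inj₁ x∈z
  ... | inj₂ (s , s∈ , x∈s) with ∈-family⁻ s∈
  ...   | p , p∈Y , refl = inj₂ (p , p∈Y , x∈s)

  ∈-⋁-family⁺ : ∀ {x p} z d Y → p ∈ Y → x ∈ d p → x ∈ ⋁ z (family d Y)
  ∈-⋁-family⁺ {p = p} z d Y p∈Y = ∈-⋁⁺ (∈-map⁺ d (∈-filter⁺ (_∈? Y) (∈-allFin p) p∈Y))

module JoinClosed {n : ℕ} (C : Subset n → Set) (C-⊥ : C ⊥)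
                  (C-∪ : ∀ {a b} → C a → C b → C (a ∪ b)) where

  C-⋁ : ∀ {S} → All C S → C (⋁ ⊥ S)
  C-⋁ [] = C-⊥
  C-⋁ (Cs ∷ CS) = C-∪ Cs (C-⋁ CS)

  joinIrr-⋁ : ∀ {Y S} → JoinIrr C ⊥ Y → All C S → ⋁ ⊥ S ≡ Y → Σ[ s ∈ Subset n ] (s ∈ₗ S × s ≡ Y)
  joinIrr-⋁ (_ , Y≢⊥ , _) [] ⊥≡Y = ⊥-elim (Y≢⊥ (sym ⊥≡Y))
  joinIrr-⋁ {S = s ∷ S} Y-irr@(_ , _ , irr) (Cs ∷ CS) s∪⋁≡Y with irr s (⋁ ⊥ S) Cs (C-⋁ CS) s∪⋁≡Y
  ... | inj₁ s≡Y = s , here refl , s≡Y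
  ... | inj₂ ⋁≡Y = let t , t∈S , t≡Y = joinIrr-⋁ Y-irr CS ⋁≡Y in t , there t∈S , t≡Y

  joinIrr-family : ∀ {Y} (d : Fin n → Subset n) → JoinIrr C ⊥ Y → (∀ {p} → p ∈ Y → C (d p)) →
                   ⋁ ⊥ (family d Y) ≡ Y → Σ[ p ∈ Fin n ] (p ∈ Y × d p ≡ Y)
  joinIrr-family d Y-irr Cd ⋁≡Y with joinIrr-⋁ Y-irr (All-family Cd) ⋁≡Y
  ... | s , s∈ , s≡Y with ∈-family⁻ s∈
  ...   | p , p∈Y , refl = p , p∈Y , s≡Y

  leastContaining-joinIrr : ∀ {Y q} → C Y → q ∈ Y → (∀ {a} → C a → q ∈ a → Y ⊆ a) → JoinIrr C ⊥ Y
  leastContaining-joinIrr {Y} {q} CY q∈Y least = CY , (λ Y≡⊥ → ∉⊥ (subst (q ∈_) Y≡⊥ q∈Y)) , irr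
    where
    irr : ∀ a b → C a → C b → a ∪ b ≡ Y → a ≡ Y ⊎ b ≡ Y
    irr a b Ca Cb a∪b≡Y with x∈p∪q⁻ a b (subst (q ∈_) (sym a∪b≡Y) q∈Y)
    ... | inj₁ q∈a = inj₁ (⊆-antisym (λ x∈a → subst (_ ∈_) a∪b≡Y (x∈p∪q⁺ (inj₁ x∈a))) (least Ca q∈a))
    ... | inj₂ q∈b = inj₂ (⊆-antisym (λ x∈b → subst (_ ∈_) a∪b≡Y (x∈p∪q⁺ (inj₂ x∈b))) (least Cb q∈b))

module Generated {n : ℕ} {H : Subset n → Set} {z : Subset n} where
  open GEL gen⟨ H ∣ z ⟩

  gen∈carrier : ∀ {h} → H h → carrier h
  gen∈carrier Hh = inj₂ (_ ∷ [] , (λ ()) , Hh ∷ [] , sym (∪-identityʳ _))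

  module _ (z⊆H : ∀ {h} → H h → z ⊆ h) where

    carrier⇒⋁ : ∀ {x} → carrier x → Σ[ S ∈ List (Subset n) ] (All H S × x ≡ ⋁ z S)
    carrier⇒⋁ (inj₁ refl) = [] , [] , refl
    carrier⇒⋁ (inj₂ ([] , S≢[] , _)) = ⊥-elim (S≢[] refl)
    carrier⇒⋁ (inj₂ (s ∷ S , _ , Hs ∷ HS , refl)) = s ∷ S , Hs ∷ HS , sym (⋁-absorbs S (z⊆H Hs))

    ⋁∈carrier : ∀ {S} → All H S → carrier (⋁ z S)
    ⋁∈carrier [] = inj₁ refl
    ⋁∈carrier {s ∷ S} (Hs ∷ HS) = inj₂ (s ∷ S , (λ ()) , Hs ∷ HS , ⋁-absorbs S (z⊆H Hs))

module Ideals {n : ℕ} (P : FinPoset n) where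
  open FinPoset P
  open IsDecPartialOrder isDecPartialOrder using (antisym) renaming (refl to ≤-refl; trans to ≤-trans)

  ∈↓⁺ : ∀ {y p} → y ≤ p → y ∈ ↓ P p
  ∈↓⁺ {y} {p} y≤p = lookup⇒[]= y (↓ P p) (trans (lookup∘tabulate _ y) (dec-true (y ≤? p) y≤p))

  ∈↓⁻ : ∀ {y p} → y ∈ ↓ P p → y ≤ p
  ∈↓⁻ {y} {p} y∈ with y ≤? p | trans (sym (lookup∘tabulate (λ x → does (x ≤? p)) y)) ([]=⇒lookup y∈)
  ... | yes y≤p | _ = y≤p
  ... | no _    | ()

  p∈↓p : ∀ p → p ∈ ↓ P p
  p∈↓p p = ∈↓⁺ ≤-refl

  ↓-injective : ∀ {p q} → ↓ P p ≡ ↓ P q → p ≡ q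
  ↓-injective {p} {q} ↓p≡↓q =
    antisym (∈↓⁻ (subst (p ∈_) ↓p≡↓q (p∈↓p p))) (∈↓⁻ (subst (q ∈_) (sym ↓p≡↓q) (p∈↓p q)))

  ↓-lowerIdeal : ∀ p → IsLowerIdeal P (↓ P p)
  ↓-lowerIdeal p x y y≤x x∈ = ∈↓⁺ (≤-trans y≤x (∈↓⁻ x∈))

  ↓⊆ : ∀ {X p} → IsLowerIdeal P X → p ∈ X → ↓ P p ⊆ X
  ↓⊆ {p = p} X-lower p∈X y∈ = X-lower p _ (∈↓⁻ y∈) p∈X

  lowerIdeal-⊥ : IsLowerIdeal P ⊥
  lowerIdeal-⊥ _ _ _ x∈⊥ = ⊥-elim (∉⊥ x∈⊥)

  lowerIdeal-∪ : ∀ {a b} → IsLowerIdeal P a → IsLowerIdeal P b → IsLowerIdeal P (a ∪ b)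
  lowerIdeal-∪ {a} {b} a-lower b-lower x y y≤x x∈ with x∈p∪q⁻ a b x∈
  ... | inj₁ x∈a = x∈p∪q⁺ (inj₁ (a-lower x y y≤x x∈a))
  ... | inj₂ x∈b = x∈p∪q⁺ (inj₂ (b-lower x y y≤x x∈b))

  ⋁-genList : ∀ {X} → IsLowerIdeal P X → ⋁ ⊥ (genList P X) ≡ X
  ⋁-genList {X} X-lower = ⊆-antisym
    (λ x∈ → [ (λ x∈⊥ → ⊥-elim (∉⊥ x∈⊥)) , (λ (p , p∈X , x∈↓p) → ↓⊆ X-lower p∈X x∈↓p) ]′
              (∈-⋁-family⁻ ⊥ (↓ P) X x∈))
    (λ x∈X → ∈-⋁-family⁺ ⊥ (↓ P) X x∈X (p∈↓p _))

  module L = JoinClosed (IsLowerIdeal P) lowerIdeal-⊥ lowerIdeal-∪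

  ↓-joinIrr : ∀ q → JoinIrr (IsLowerIdeal P) ⊥ (↓ P q)
  ↓-joinIrr q = L.leastContaining-joinIrr (↓-lowerIdeal q) (p∈↓p q) ↓⊆

  joinIrr⇒↓ : ∀ {g} → JoinIrr (IsLowerIdeal P) ⊥ g → Σ[ q ∈ Fin n ] (q ∈ g × ↓ P q ≡ g)
  joinIrr⇒↓ g-irr = L.joinIrr-family (↓ P) g-irr (λ _ → ↓-lowerIdeal _) (⋁-genList (proj₁ g-irr))

  module _ (I : Subset n) where

    lowerIdealOf-⊥ : IsLowerIdealOf P I ⊥
    lowerIdealOf-⊥ = (λ x∈⊥ → ⊥-elim (∉⊥ x∈⊥)) , (λ _ _ _ _ x∈⊥ → ⊥-elim (∉⊥ x∈⊥))

    lowerIdealOf-∪ : ∀ {a b} → IsLowerIdealOf P I a → IsLowerIdealOf P I b → IsLowerIdealOf P I (a ∪ b)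
    lowerIdealOf-∪ {a} {b} (a⊆I , a-lower) (b⊆I , b-lower) = ∪⊆I , ∪-lower
      where
      ∪⊆I : a ∪ b ⊆ I
      ∪⊆I x∈ = [ a⊆I , b⊆I ]′ (x∈p∪q⁻ a b x∈)
      ∪-lower : ∀ x y → y ∈ I → y ≤ x → x ∈ a ∪ b → y ∈ a ∪ b
      ∪-lower x y y∈I y≤x x∈ with x∈p∪q⁻ a b x∈
      ... | inj₁ x∈a = x∈p∪q⁺ (inj₁ (a-lower x y y∈I y≤x x∈a))
      ... | inj₂ x∈b = x∈p∪q⁺ (inj₂ (b-lower x y y∈I y≤x x∈b))

    ∩-lowerIdealOf : ∀ {X} → IsLowerIdeal P X → IsLowerIdealOf P I (X ∩ I)
    ∩-lowerIdealOf {X} X-lower =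
      (λ x∈ → proj₂ (x∈p∩q⁻ X I x∈)) ,
      (λ x y y∈I y≤x x∈ → x∈p∩q⁺ (X-lower x y y≤x (proj₁ (x∈p∩q⁻ X I x∈)) , y∈I))

    ↓∩⊆ : ∀ {Y p} → IsLowerIdealOf P I Y → p ∈ Y → ↓ P p ∩ I ⊆ Y
    ↓∩⊆ {p = p} (_ , Y-lower) p∈Y y∈ =
      let y∈↓p , y∈I = x∈p∩q⁻ (↓ P p) I y∈ in Y-lower p _ y∈I (∈↓⁻ y∈↓p) p∈Y

    ⋁-family-↓∩ : ∀ {Y} → IsLowerIdealOf P I Y → ⋁ ⊥ (family (λ p → ↓ P p ∩ I) Y) ≡ Y
    ⋁-family-↓∩ {Y} Y-lower = ⊆-antisym
      (λ x∈ → [ (λ x∈⊥ → ⊥-elim (∉⊥ x∈⊥)) , (λ (p , p∈Y , x∈↓p∩I) → ↓∩⊆ Y-lower p∈Y x∈↓p∩I) ]′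
                (∈-⋁-family⁻ ⊥ _ Y x∈))
      (λ x∈Y → ∈-⋁-family⁺ ⊥ _ Y x∈Y (x∈p∩q⁺ (p∈↓p _ , proj₁ Y-lower x∈Y)))

    module M = JoinClosed (IsLowerIdealOf P I) lowerIdealOf-⊥ lowerIdealOf-∪

    ↓∩-joinIrr : ∀ {q} → q ∈ I → JoinIrr (IsLowerIdealOf P I) ⊥ (↓ P q ∩ I)
    ↓∩-joinIrr {q} q∈I =
      M.leastContaining-joinIrr (∩-lowerIdealOf (↓-lowerIdeal q)) (x∈p∩q⁺ (p∈↓p q , q∈I)) ↓∩⊆

    joinIrr⇒↓∩ : ∀ {Y} → JoinIrr (IsLowerIdealOf P I) ⊥ Y → Σ[ q ∈ Fin n ] (q ∈ Y × ↓ P q ∩ I ≡ Y)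
    joinIrr⇒↓∩ Y-irr =
      M.joinIrr-family _ Y-irr (λ _ → ∩-lowerIdealOf (↓-lowerIdeal _)) (⋁-family-↓∩ (proj₁ Y-irr))

module Minor {n : ℕ} (P : FinPoset n) (I J : Subset n)
             (I∩J≡∅ : ∀ x → x ∈ I → x ∉ J) (J-lower : IsLowerIdeal P J) where
  open FinPoset P using (_≤_)
  open Ideals P
  open ≡-Reasoning

  K : GEL n
  K = restriction (Lgel P) (genSet P (I ∪ J))

  minor : GEL n
  minor = minorGEL P I J

  i₀ : Subset n
  i₀ = ⋁ ⊥ (genList P J)

  i₀≡J : i₀ ≡ J
  i₀≡J = ⋁-genList J-lower

  J∩I≡⊥ : J ∩ I ≡ ⊥
  J∩I≡⊥ = ⊆-antisym (λ x∈ → let x∈J , x∈I = x∈p∩q⁻ J I x∈ in ⊥-elim (I∩J≡∅ _ x∈I x∈J))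
                    (λ x∈⊥ → ⊥-elim (∉⊥ x∈⊥))

  restrictionGen⇒↓ : ∀ {g} → GEL.gens K g → Σ[ q ∈ Fin n ] (q ∈ I ∪ J × ↓ P q ≡ g)
  restrictionGen⇒↓ (g-irr , kept) with joinIrr⇒↓ g-irr
  ... | q , _ , ↓q≡g with q ∈? I ∪ J
  ...   | yes q∈ = q , q∈ , ↓q≡g
  ...   | no q∉ = ⊥-elim (kept (g-irr , λ (q′ , q′∈ , g≡↓q′) →
                    q∉ (subst (_∈ I ∪ J) (↓-injective (trans (sym g≡↓q′) (sym ↓q≡g))) q′∈)))

  minorGen⇒↓∪J : ∀ {y} → GEL.gens minor y → Σ[ q ∈ Fin n ] (q ∈ I × y ≡ ↓ P q ∪ J)
  minorGen⇒↓∪J (g , g-gen , refl , y≢i₀) with restrictionGen⇒↓ g-gen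
  ... | q , q∈ , refl with x∈p∪q⁻ I J q∈
  ...   | inj₁ q∈I = q , q∈I , cong (↓ P q ∪_) i₀≡J
  ...   | inj₂ q∈J = ⊥-elim (y≢i₀ (begin
          ↓ P q ∪ i₀  ≡⟨ cong (↓ P q ∪_) i₀≡J ⟩
          ↓ P q ∪ J   ≡⟨ p⊆q⇒p∪q≡q (↓⊆ J-lower q∈J) ⟩
          J           ≡⟨ sym i₀≡J ⟩
          i₀          ∎))

  ↓∪J-minorGen : ∀ {q} → q ∈ I → GEL.gens minor (↓ P q ∪ J)
  ↓∪J-minorGen {q} q∈I =
    ↓ P q ,
    (↓-joinIrr q , λ (_ , deleted) → deleted (q , x∈p∪q⁺ (inj₁ q∈I) , refl)) ,
    cong (↓ P q ∪_) (sym i₀≡J) ,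
    λ ↓q∪J≡i₀ → I∩J≡∅ q q∈I (subst (q ∈_) (trans ↓q∪J≡i₀ i₀≡J) (x∈p∪q⁺ (inj₁ (p∈↓p q))))

  i₀⊆minorGen : ∀ {h} → GEL.gens minor h → i₀ ⊆ h
  i₀⊆minorGen (g , _ , refl , _) = q⊆p∪q g i₀

  open Generated {H = GEL.gens minor} {z = i₀}

  IsMinorElement : Subset n → Set
  IsMinorElement x = IsLowerIdeal P x × J ⊆ x ×
                     (∀ {y} → y ∈ x → y ∈ J ⊎ Σ[ p ∈ Fin n ] (p ∈ x × p ∈ I × y ≤ p))

  minorElement-∪ : ∀ {a b} → IsMinorElement a → IsMinorElement b → IsMinorElement (a ∪ b)
  minorElement-∪ {a} {b} (a-lower , J⊆a , a-covered) (b-lower , _ , b-covered) =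
    lowerIdeal-∪ a-lower b-lower , (λ y∈J → x∈p∪q⁺ (inj₁ (J⊆a y∈J))) , covered
    where
    covered : ∀ {y} → y ∈ a ∪ b → y ∈ J ⊎ Σ[ p ∈ Fin n ] (p ∈ a ∪ b × p ∈ I × y ≤ p)
    covered y∈ with x∈p∪q⁻ a b y∈
    ... | inj₁ y∈a = map₂ (λ (p , p∈a , pI , y≤p) → p , x∈p∪q⁺ (inj₁ p∈a) , pI , y≤p) (a-covered y∈a)
    ... | inj₂ y∈b = map₂ (λ (p , p∈b , pI , y≤p) → p , x∈p∪q⁺ (inj₂ p∈b) , pI , y≤p) (b-covered y∈b)

  minorElement-↓∪J : ∀ {q} → q ∈ I → IsMinorElement (↓ P q ∪ J)
  minorElement-↓∪J {q} q∈I = lowerIdeal-∪ (↓-lowerIdeal q) J-lower , (λ y∈J → x∈p∪q⁺ (inj₂ y∈J)) , covered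
    where
    covered : ∀ {y} → y ∈ ↓ P q ∪ J → y ∈ J ⊎ Σ[ p ∈ Fin n ] (p ∈ ↓ P q ∪ J × p ∈ I × y ≤ p)
    covered y∈ = [ (λ y∈↓q → inj₂ (q , x∈p∪q⁺ (inj₁ (p∈↓p q)) , q∈I , ∈↓⁻ y∈↓q)) , inj₁ ]′ (x∈p∪q⁻ (↓ P q) J y∈)

  minorElement-i₀ : IsMinorElement i₀
  minorElement-i₀ = subst IsMinorElement (sym i₀≡J) (J-lower , (λ y∈J → y∈J) , inj₁)

  ⋁-minorElement : ∀ {S} → All (GEL.gens minor) S → IsMinorElement (⋁ i₀ S)
  ⋁-minorElement [] = minorElement-i₀
  ⋁-minorElement (s-gen ∷ S-gen) with minorGen⇒↓∪J s-gen
  ... | q , q∈I , refl = minorElement-∪ (minorElement-↓∪J q∈I) (⋁-minorElement S-gen)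

  carrier⇒minorElement : ∀ {x} → GEL.carrier minor x → IsMinorElement x
  carrier⇒minorElement x∈ with carrier⇒⋁ i₀⊆minorGen x∈
  ... | _ , S-gen , refl = ⋁-minorElement S-gen

  minorElement-∩-injective : ∀ {x y} → IsMinorElement x → IsMinorElement y → x ∩ I ≡ y ∩ I → x ≡ y
  minorElement-∩-injective x-min y-min x∩I≡y∩I =
    ⊆-antisym (⊆-from x-min y-min x∩I≡y∩I) (⊆-from y-min x-min (sym x∩I≡y∩I))
    where
    ⊆-from : ∀ {x y} → IsMinorElement x → IsMinorElement y → x ∩ I ≡ y ∩ I → x ⊆ y
    ⊆-from {x} {y} (_ , _ , x-covered) (y-lower , J⊆y , _) x∩I≡y∩I z∈x with x-covered z∈x
    ... | inj₁ z∈J = J⊆y z∈J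
    ... | inj₂ (p , p∈x , p∈I , z≤p) =
      y-lower p _ z≤p (proj₁ (x∈p∩q⁻ y I (subst (p ∈_) x∩I≡y∩I (x∈p∩q⁺ (p∈x , p∈I)))))

  i₀∩I≡⊥ : i₀ ∩ I ≡ ⊥
  i₀∩I≡⊥ = trans (cong (_∩ I) i₀≡J) J∩I≡⊥

  ↓∪J∩I≡↓∩I : ∀ q → (↓ P q ∪ J) ∩ I ≡ ↓ P q ∩ I
  ↓∪J∩I≡↓∩I q = begin
    (↓ P q ∪ J) ∩ I        ≡⟨ ∩-distribʳ-∪ I (↓ P q) J ⟩
    ↓ P q ∩ I ∪ J ∩ I      ≡⟨ cong (↓ P q ∩ I ∪_) J∩I≡⊥ ⟩
    ↓ P q ∩ I ∪ ⊥          ≡⟨ ∪-identityʳ (↓ P q ∩ I) ⟩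
    ↓ P q ∩ I              ∎

  preimage : Subset n → Subset n
  preimage Y = ⋁ i₀ (family (λ q → ↓ P q ∪ J) Y)

  preimage∈carrier : ∀ {Y} → Y ⊆ I → GEL.carrier minor (preimage Y)
  preimage∈carrier Y⊆I = ⋁∈carrier i₀⊆minorGen (All-family (λ q∈Y → ↓∪J-minorGen (Y⊆I q∈Y)))

  preimage-∩ : ∀ {Y} → IsLowerIdealOf P I Y → preimage Y ∩ I ≡ Y
  preimage-∩ {Y} Y-lower = begin
    ⋁ i₀ (map ↓∪J qs) ∩ I                     ≡⟨ ⋁-∩ i₀ I (map ↓∪J qs) ⟩
    ⋁ (i₀ ∩ I) (map (_∩ I) (map ↓∪J qs))      ≡⟨ cong₂ ⋁ i₀∩I≡⊥ (trans (sym (map-∘ qs)) (map-cong ↓∪J∩I≡↓∩I qs)) ⟩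
    ⋁ ⊥ (family (λ q → ↓ P q ∩ I) Y)          ≡⟨ ⋁-family-↓∩ I Y-lower ⟩
    Y                                          ∎
    where
    ↓∪J : Fin n → Subset n
    ↓∪J q = ↓ P q ∪ J
    qs : List (Fin n)
    qs = filter (_∈? Y) (allFin n)

  minor≅lowerIdealsOfI : GELIso minor (Mgel P I)
  minor≅lowerIdealsOfI = record
    { f       = _∩ I
    ; f-into  = λ _ x∈ → ∩-lowerIdealOf I (proj₁ (carrier⇒minorElement x∈))
    ; f-inj   = λ _ _ x∈ y∈ → minorElement-∩-injective (carrier⇒minorElement x∈) (carrier⇒minorElement y∈)
    ; f-surj  = λ Y Y-lower → preimage Y , preimage∈carrier (proj₁ Y-lower) , preimage-∩ Y-lower
    ; f-join  = λ x y _ _ → ∩-distribʳ-∪ I x y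
    ; f-gens  = gens→gens
    ; f-gens⁻ = gens←gens
    }
    where
    gens→gens : ∀ x → GEL.gens minor x ⊎ x ≡ i₀ →
                JoinIrr (IsLowerIdealOf P I) ⊥ (x ∩ I) ⊎ x ∩ I ≡ ⊥
    gens→gens _ (inj₂ refl) = inj₂ i₀∩I≡⊥
    gens→gens _ (inj₁ x-gen) with minorGen⇒↓∪J x-gen
    ... | q , q∈I , refl = inj₁ (subst (JoinIrr _ ⊥) (sym (↓∪J∩I≡↓∩I q)) (↓∩-joinIrr I q∈I))

    gens←gens : ∀ Y → JoinIrr (IsLowerIdealOf P I) ⊥ Y ⊎ Y ≡ ⊥ →
                Σ[ x ∈ Subset n ] (GEL.carrier minor x × (GEL.gens minor x ⊎ x ≡ i₀) × x ∩ I ≡ Y)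
    gens←gens _ (inj₂ refl) = i₀ , inj₁ refl , inj₂ refl , i₀∩I≡⊥
    gens←gens _ (inj₁ Y-irr) with joinIrr⇒↓∩ I Y-irr
    ... | q , q∈Y , ↓q∩I≡Y =
      ↓ P q ∪ J , gen∈carrier q-gen , inj₁ q-gen , trans (↓∪J∩I≡↓∩I q) ↓q∩I≡Y
      where q-gen = ↓∪J-minorGen (proj₁ (proj₁ Y-irr) q∈Y)

mainTheorem14 : (n : ℕ) (P : FinPoset n) (I J : Subset n) →
    IsOrderMinor P I J → GELIso (minorGEL P I J) (Mgel P I)
mainTheorem14 n P I J (I∩J≡∅ , J-lower) = Minor.minor≅lowerIdealsOfI P I J I∩J≡∅ J-lower
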